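{- Let $k$, $k'$, $\ell$, and $t$ be positive integers. Then there exists $n_0 = n_0(k,k',\ell,t)$ such that for every integer $n \geq n_0$ the following holds. Suppose that two families $\mathcal{F} \subseteq \binom{[n]}{k}$ and $\mathcal{F}' \subseteq \binom{[n]}{k'}$ are $\ell$-weakly cross $t$-intersecting, that is, \[ \sum_{1 \leq i, j \leq \ell} \lvert F_i \cap F_j' \rvert \geq \ell^2 t - \ell + 1 \] for every choice of $\ell$ distinct members $F_1, \ldots, F_\ell \in \mathcal{F}$ and $\ell$ distinct members $F_1', \ldots, F_\ell' \in \mathcal{F}'$. Then \[ \lvert \mathcal{F} \rvert \cdot \lvert \mathcal{F}' \rvert \leq \binom{n-t}{k-t} \binom{n-t}{k'-t}. \]
   Context: For a positive integer $n$, $[n]=\{1,\dots,n\}$, and $\binom{[n]}{k}$ denotes the family of all $k$-element subsets of $[n]$. -}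

module Defs where

open import Data.Nat using (ℕ; _+_; _*_; _∸_; _≤_)
open import Data.Nat.ListAction using (sum)
open import Data.Fin using (Fin)
open import Data.Fin.Subset using (Subset; _∩_; ∣_∣)
open import Data.List using (List; tabulate; length)
open import Data.List.Relation.Unary.All using (All)
open import Data.List.Relation.Unary.Unique.Propositional using (Unique)
open import Data.List.Membership.Propositional using (_∈_)
open import Relation.Binary.PropositionalEquality using (_≡_)
open import Function.Definitions using (Injective)

-- A family 𝓕 ⊆ ([n] choose k): a duplicate-free list of subsets of [n]
-- (subsets of Fin n), each of cardinality k.  |𝓕| = length 𝓕.
record UniformFamily (n k : ℕ) (𝓕 : List (Subset n)) : Set where
  field
    distinct : Unique 𝓕
    uniform  : All (λ A → ∣ A ∣ ≡ k) 𝓕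

∑ : ∀ {ℓ} → (Fin ℓ → ℕ) → ℕ
∑ f = sum (tabulate f)

DistinctMembers : ∀ {n} (ℓ : ℕ) → List (Subset n) → (Fin ℓ → Subset n) → Set
DistinctMembers ℓ 𝓕 F = Injective _≡_ _≡_ F × (∀ i → F i ∈ 𝓕)
  where open import Data.Product using (_×_)

WeaklyCrossIntersecting : ∀ {n} (ℓ t : ℕ) → List (Subset n) → List (Subset n) → Set
WeaklyCrossIntersecting ℓ t 𝓕 𝓕' =
  (F F' : Fin ℓ → Subset _) → DistinctMembers ℓ 𝓕 F → DistinctMembers ℓ 𝓕' F' →
  ℓ * ℓ * t ∸ ℓ + 1 ≤ ∑ (λ i → ∑ (λ j → ∣ F i ∩ F' j ∣))

module Submission where

-- Fix ℓ distinct members of 𝓕' and let U be their union, so |U| ≤ ℓk'. Fewer than ℓ members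
-- of 𝓕 meet U in fewer than t points, since ℓ of them would make every term of the cross sum
-- smaller than t. The others contain a t-subset of U, so |𝓕| ≤ ℓ − 1 + 2^(ℓk') · d, where d
-- bounds the degrees of t-sets in 𝓕.
-- A t-set T of degree at least ℓ + 2^(t+ℓk') · C(n−t−1, k−t−1) in 𝓕 lies in every member B
-- of 𝓕': otherwise take ℓ members of 𝓕' starting with B and let V be T together with their
-- union. Members of 𝓕 through T meeting V in more than t points contain one of the at most
-- 2^(t+ℓk') (t+1)-subsets of V; ℓ of the remaining ones, whose trace on V is exactly T, would
-- make every row of the cross sum smaller than ℓt, because T ⊄ B.
-- Hence either some t-set lies in all members of both families, and the bound is a product of
-- two star bounds, or one family has size O(C(n−t−1, k−t−1)) while the other has size
-- O(C(n−t, k'−t)); as C(n−t, k−t) = (n−t)/(k−t) · C(n−t−1, k−t−1), the constants are absorbed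
-- for large n. If k = t the bound for 𝓕 is useless and the families are exchanged; if also
-- k' = t, the cross sum forces ℓ = 1.

open import Defs
open import Data.Bool using (Bool)
import Data.Bool.Properties as Bool
open import Data.Empty using (⊥; ⊥-elim)
open import Data.Fin using (Fin; zero; suc; inject≤)
open import Data.Fin.Properties using (inject≤-injective)
open import Data.Fin.Subset using (Subset; inside; outside; _∩_; _∪_; ∣_∣; _⊆_; ⋃) renaming (⊥ to ∅)
open import Data.Fin.Subset.Properties
  using (_⊆?_; ⊆-trans; drop-∷-⊆; out⊆; in⊆in; ⊥⊆; ∣⊥∣≡0; ∣p∣≤n; p⊆q⇒∣p∣≤∣q∣; p∩q⊆p; p∩q⊆q;
         x∈p∩q⁺; ∣p∩q∣≤∣p∣; ∩-comm; p⊆p∪q; q⊆p∪q; anySubset?)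
open import Data.List using (List; []; _∷_; [_]; _++_; length; map; filter; tabulate; lookup)
open import Data.List.Properties
  using (length-map; length-++; length-filter; length-tabulate; filter-all; filter-none)
open import Data.List.Relation.Unary.All as All using (All; []; _∷_)
open import Data.List.Relation.Unary.All.Properties
  using (all-filter; tabulate⁺) renaming (filter⁺ to All-filter⁺)
open import Data.List.Relation.Unary.AllPairs using ([]; _∷_)
open import Data.List.Relation.Unary.Any using (Any; here; there)
open import Data.List.Relation.Unary.Any.Properties using (¬Any[])
open import Data.List.Relation.Unary.Unique.Propositional using (Unique)
open import Data.List.Relation.Unary.Unique.Propositional.Properties
  using () renaming (filter⁺ to Unique-filter⁺)
open import Data.List.Membership.Propositional using (_∈_; lose)
open import Data.List.Membership.Propositional.Properties
  using (∈-map⁺; ∈-++⁺ˡ; ∈-++⁺ʳ; ∈-filter⁺; ∈-filter⁻; ∈-lookup; ∈-tabulate⁺)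
open import Data.Nat
  using (ℕ; zero; suc; pred; _+_; _*_; _∸_; _^_; _≤_; _<_; _≤?_; _≟_; z≤n; s≤s; >-nonZero)
open import Data.Nat.Combinatorics using (_C_; nCk+nC[k+1]≡[n+1]C[k+1]; nC1≡n)
open import Data.Nat.Properties
open import Data.Nat.Solver using (module +-*-Solver)
open import Data.Product using (Σ; ∃-syntax; _×_; _,_; proj₁; proj₂)
open import Data.Sum using (_⊎_; inj₁; inj₂)
import Data.Vec.Base as Vec
open import Data.Vec.Base using ([]; _∷_)
open import Data.Vec.Properties using (≡-dec)
open import Function using (_∘_)
open import Function.Definitions using (Injective)
open import Level using (0ℓ)
open import Relation.Binary.Definitions using (DecidableEquality)
open import Relation.Binary.PropositionalEquality
  using (_≡_; _≢_; refl; sym; trans; cong; cong₂; subst; subst₂; module ≡-Reasoning)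
open import Relation.Nullary using (¬_; yes; no; ¬?; contradiction)
open import Relation.Nullary.Decidable using (_×-dec_)
open import Relation.Unary using (Pred; Decidable)
open import Relation.Unary.Properties using (∁?; _∩?_)

open import Algebra.Properties.CommutativeSemigroup +-commutativeSemigroup using (interchange)
open +-*-Solver using (solve; _:+_; _:*_; _:=_; con)

-- Binomial coefficients and thresholds

[k+1]*[n+1]C[k+1]≡[n+1]*nCk : ∀ n k → suc k * (suc n C suc k) ≡ suc n * (n C k)
[k+1]*[n+1]C[k+1]≡[n+1]*nCk zero    zero    = refl
[k+1]*[n+1]C[k+1]≡[n+1]*nCk zero    (suc k) = *-zeroʳ (suc (suc k))
[k+1]*[n+1]C[k+1]≡[n+1]*nCk (suc n) zero    =
  trans (+-identityʳ _) (trans (nC1≡n (suc (suc n))) (sym (*-identityʳ (suc (suc n)))))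
[k+1]*[n+1]C[k+1]≡[n+1]*nCk (suc n) (suc k) = begin
  suc (suc k) * (suc (suc n) C suc (suc k))  ≡⟨ cong (suc (suc k) *_) (nCk+nC[k+1]≡[n+1]C[k+1] (suc n) (suc k)) ⟨
  suc (suc k) * (A + B)                      ≡⟨ solve 3 (λ k A B → (con 2 :+ k) :* (A :+ B)
                                                                := (con 1 :+ k) :* A :+ A :+ (con 2 :+ k) :* B) refl k A B ⟩
  suc k * A + A + suc (suc k) * B            ≡⟨ cong₂ (λ x y → x + A + y) ([k+1]*[n+1]C[k+1]≡[n+1]*nCk n k)
                                                                          ([k+1]*[n+1]C[k+1]≡[n+1]*nCk n (suc k)) ⟩
  suc n * (n C k) + A + suc n * (n C suc k)  ≡⟨ solve 4 (λ n a A b → (con 1 :+ n) :* a :+ A :+ (con 1 :+ n) :* b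
                                                                  := (con 1 :+ n) :* (a :+ b) :+ A) refl n (n C k) A (n C suc k) ⟩
  suc n * (n C k + n C suc k) + A            ≡⟨ cong (λ x → suc n * x + A) (nCk+nC[k+1]≡[n+1]C[k+1] n k) ⟩
  suc n * A + A                              ≡⟨ solve 2 (λ n A → (con 1 :+ n) :* A :+ A := (con 2 :+ n) :* A) refl n A ⟩
  suc (suc n) * A                            ∎
  where
  open ≡-Reasoning
  A = suc n C suc k
  B = suc n C suc (suc k)

k≤n⇒0<nCk : ∀ {n k} → k ≤ n → 0 < n C k
k≤n⇒0<nCk {k = zero} _ = s≤s z≤n
k≤n⇒0<nCk {suc n} {suc k} (s≤s k≤n) =
  <-≤-trans (k≤n⇒0<nCk k≤n) (≤-trans (m≤m+n _ _) (≤-reflexive (nCk+nC[k+1]≡[n+1]C[k+1] n k)))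

M*[pred[m]Cp]≤mC[1+p] : ∀ M m p → M * suc p ≤ m → M * (pred m C p) ≤ m C suc p
M*[pred[m]Cp]≤mC[1+p] zero    m       p _    = z≤n
M*[pred[m]Cp]≤mC[1+p] (suc M) (suc m) p Mp≤m = *-cancelˡ-≤ (suc p) (begin
  suc p * (suc M * (m C p))  ≡⟨ solve 3 (λ p M c → (con 1 :+ p) :* ((con 1 :+ M) :* c)
                                                := ((con 1 :+ M) :* (con 1 :+ p)) :* c) refl p M (m C p) ⟩
  suc M * suc p * (m C p)    ≤⟨ *-monoˡ-≤ (m C p) Mp≤m ⟩
  suc m * (m C p)            ≡⟨ [k+1]*[n+1]C[k+1]≡[n+1]*nCk m p ⟨
  suc p * (suc m C suc p)    ∎)
  where open ≤-Reasoning

-- m C⁻ p = C(m, p − 1), except that it is 0 (not 1) for p = 0.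
_C⁻_ : ℕ → ℕ → ℕ
m C⁻ zero  = 0
m C⁻ suc p = m C p

*≤*-via-L² : ∀ {a b x y z} L → a ≤ L * z → L * L * z ≤ x → b ≤ L * y → a * b ≤ x * y
*≤*-via-L² {a} {b} {x} {y} {z} L a≤Lz LLz≤x b≤Ly = begin
  a * b            ≤⟨ *-mono-≤ a≤Lz b≤Ly ⟩
  L * z * (L * y)  ≡⟨ solve 3 (λ L z y → L :* z :* (L :* y) := L :* L :* z :* y) refl L z y ⟩
  L * L * z * y    ≤⟨ *-monoˡ-≤ y LLz≤x ⟩
  x * y            ∎
  where open ≤-Reasoning

module Thresholds (ℓ′ K : ℕ) where

  L : ℕ
  L = suc ℓ′ + K * (suc ℓ′ + K)

  small≤L* : ∀ {z} → 0 < z → ℓ′ + K * (ℓ′ + K * z) ≤ L * z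
  small≤L* {z} 0<z = begin
    ℓ′ + K * (ℓ′ + K * z)        ≤⟨ +-mono-≤ (n≤1+n ℓ′) (*-monoʳ-≤ K (+-monoˡ-≤ (K * z) (n≤1+n ℓ′))) ⟩
    ℓ + K * (ℓ + K * z)          ≡⟨ solve 3 (λ ℓ K z → ℓ :+ K :* (ℓ :+ K :* z) := (ℓ :+ K :* ℓ) :+ K :* K :* z)
                                            refl ℓ K z ⟩
    (ℓ + K * ℓ) + K * K * z      ≤⟨ +-monoˡ-≤ (K * K * z) (≤-trans (≤-reflexive (sym (*-identityʳ _)))
                                                                   (*-monoʳ-≤ (ℓ + K * ℓ) 0<z)) ⟩
    (ℓ + K * ℓ) * z + K * K * z  ≡⟨ solve 3 (λ ℓ K z → (ℓ :+ K :* ℓ) :* z :+ K :* K :* z := (ℓ :+ K :* (ℓ :+ K)) :* z)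
                                            refl ℓ K z ⟩
    L * z                        ∎
    where
    open ≤-Reasoning
    ℓ = suc ℓ′

  crude≤L* : ∀ {z} → 0 < K → 0 < z → ℓ′ + K * z ≤ L * z
  crude≤L* {z} 0<K 0<z = ≤-trans (+-monoʳ-≤ ℓ′ (*-monoʳ-≤ K z≤ℓ′+Kz)) (small≤L* 0<z)
    where
    z≤ℓ′+Kz : z ≤ ℓ′ + K * z
    z≤ℓ′+Kz = ≤-trans (m≤n*m z K {{>-nonZero 0<K}}) (m≤n+m (K * z) ℓ′)

module Binomials (L t k n : ℕ) (0<L : 0 < L) (n-large : t + L * L * k ≤ n) where

  X E : ℕ
  X = (n ∸ t) C (k ∸ t)
  E = (n ∸ suc t) C⁻ (k ∸ t)

  LL[k∸t]≤n∸t : L * L * (k ∸ t) ≤ n ∸ t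
  LL[k∸t]≤n∸t = ≤-trans (*-monoʳ-≤ (L * L) (m∸n≤m k t))
                        (subst (_≤ n ∸ t) (m+n∸m≡n t (L * L * k)) (∸-monoˡ-≤ t n-large))

  k∸t≤n∸t : k ∸ t ≤ n ∸ t
  k∸t≤n∸t = ≤-trans (m≤n*m (k ∸ t) (L * L) {{>-nonZero (*-mono-< 0<L 0<L)}}) LL[k∸t]≤n∸t

  0<X : 0 < X
  0<X = k≤n⇒0<nCk k∸t≤n∸t

  LLE≤X : L * L * E ≤ X
  LLE≤X with k ∸ t | LL[k∸t]≤n∸t
  ... | zero  | _     = ≤-trans (≤-reflexive (*-zeroʳ (L * L))) z≤n
  ... | suc p | LLp≤m = subst (λ m → L * L * (m C p) ≤ (n ∸ t) C suc p) (pred[m∸n]≡m∸[1+n] n t)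
                              (M*[pred[m]Cp]≤mC[1+p] (L * L) (n ∸ t) p LLp≤m)

  k≤t×E≡0⊎0<E : (k ≤ t × E ≡ 0) ⊎ 0 < E
  k≤t×E≡0⊎0<E with k ∸ t in k∸t≡ | k∸t≤n∸t
  ... | zero  | _   = inj₁ (m∸n≡0⇒m≤n k∸t≡ , refl)
  ... | suc p | p<m = inj₂ (k≤n⇒0<nCk (subst (p ≤_) (pred[m∸n]≡m∸[1+n] n t) (<⇒≤pred p<m)))

-- Sums and subsets

∑-mono-≤ : ∀ {ℓ} {f g : Fin ℓ → ℕ} → (∀ i → f i ≤ g i) → ∑ f ≤ ∑ g
∑-mono-≤ {zero}  _   = z≤n
∑-mono-≤ {suc ℓ} f≤g = +-mono-≤ (f≤g zero) (∑-mono-≤ (f≤g ∘ suc))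

∑-const : ∀ ℓ c → ∑ {ℓ} (λ _ → c) ≡ ℓ * c
∑-const zero    c = refl
∑-const (suc ℓ) c = cong (c +_) (∑-const ℓ c)

∑-< : ∀ {ℓ c} {f : Fin ℓ → ℕ} → (∀ i → f i ≤ c) → ∀ i → f i < c → ∑ f < ℓ * c
∑-< {suc ℓ} {c} f≤c zero    f₀<c = +-mono-<-≤ f₀<c (≤-trans (∑-mono-≤ (f≤c ∘ suc)) (≤-reflexive (∑-const ℓ c)))
∑-< {suc ℓ}     f≤c (suc i) fᵢ<c = +-mono-≤-< (f≤c zero) (∑-< (f≤c ∘ suc) i fᵢ<c)

∑-+ : ∀ {ℓ} (f g : Fin ℓ → ℕ) → ∑ (λ i → f i + g i) ≡ ∑ f + ∑ g
∑-+ {zero}  f g = refl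
∑-+ {suc ℓ} f g =
  trans (cong (f zero + g zero +_) (∑-+ (f ∘ suc) (g ∘ suc))) (interchange (f zero) (g zero) _ _)

∑-swap : ∀ {ℓ m} (f : Fin ℓ → Fin m → ℕ) → ∑ (λ i → ∑ (f i)) ≡ ∑ (λ j → ∑ (λ i → f i j))
∑-swap {zero}  {m} f = sym (trans (∑-const m 0) (*-zeroʳ m))
∑-swap {suc ℓ}     f = trans (cong (∑ (f zero) +_) (∑-swap (f ∘ suc))) (sym (∑-+ (f zero) _))

∣p∪q∣≤∣p∣+∣q∣ : ∀ {n} (p q : Subset n) → ∣ p ∪ q ∣ ≤ ∣ p ∣ + ∣ q ∣
∣p∪q∣≤∣p∣+∣q∣ []            []            = z≤n
∣p∪q∣≤∣p∣+∣q∣ (outside ∷ p) (outside ∷ q) = ∣p∪q∣≤∣p∣+∣q∣ p q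
∣p∪q∣≤∣p∣+∣q∣ (outside ∷ p) (inside  ∷ q) =
  subst (suc ∣ p ∪ q ∣ ≤_) (sym (+-suc ∣ p ∣ ∣ q ∣)) (s≤s (∣p∪q∣≤∣p∣+∣q∣ p q))
∣p∪q∣≤∣p∣+∣q∣ (inside  ∷ p) (outside ∷ q) = s≤s (∣p∪q∣≤∣p∣+∣q∣ p q)
∣p∪q∣≤∣p∣+∣q∣ (inside  ∷ p) (inside  ∷ q) =
  s≤s (≤-trans (∣p∪q∣≤∣p∣+∣q∣ p q) (+-monoʳ-≤ ∣ p ∣ (n≤1+n ∣ q ∣)))

inside∷p⊈outside∷q : ∀ {n} {p q : Subset n} → ¬ (inside ∷ p ⊆ outside ∷ q)
inside∷p⊈outside∷q p⊆q with p⊆q Vec.here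
... | ()

p⊆q⇒∣q∣≤∣p∣⇒p≡q : ∀ {n} {p q : Subset n} → p ⊆ q → ∣ q ∣ ≤ ∣ p ∣ → p ≡ q
p⊆q⇒∣q∣≤∣p∣⇒p≡q {p = []}          {[]}          _   _         = refl
p⊆q⇒∣q∣≤∣p∣⇒p≡q {p = outside ∷ p} {outside ∷ q} p⊆q q≤p       =
  cong (outside ∷_) (p⊆q⇒∣q∣≤∣p∣⇒p≡q (drop-∷-⊆ p⊆q) q≤p)
p⊆q⇒∣q∣≤∣p∣⇒p≡q {p = outside ∷ p} {inside  ∷ q} p⊆q q<p       =
  contradiction (p⊆q⇒∣p∣≤∣q∣ (drop-∷-⊆ p⊆q)) (<⇒≱ q<p)
p⊆q⇒∣q∣≤∣p∣⇒p≡q {p = inside  ∷ p} {outside ∷ q} p⊆q _         = ⊥-elim (inside∷p⊈outside∷q p⊆q)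
p⊆q⇒∣q∣≤∣p∣⇒p≡q {p = inside  ∷ p} {inside  ∷ q} p⊆q (s≤s q≤p) =
  cong (inside ∷_) (p⊆q⇒∣q∣≤∣p∣⇒p≡q (drop-∷-⊆ p⊆q) q≤p)

p⊆q⇒p≢q⇒∣p∣<∣q∣ : ∀ {n} {p q : Subset n} → p ⊆ q → p ≢ q → ∣ p ∣ < ∣ q ∣
p⊆q⇒p≢q⇒∣p∣<∣q∣ p⊆q p≢q = ≰⇒> (p≢q ∘ p⊆q⇒∣q∣≤∣p∣⇒p≡q p⊆q)

∣p∣≡∣q∣⇒p≢q⇒∣p∩q∣<∣p∣ : ∀ {n} {p q : Subset n} → ∣ p ∣ ≡ ∣ q ∣ → p ≢ q → ∣ p ∩ q ∣ < ∣ p ∣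
∣p∣≡∣q∣⇒p≢q⇒∣p∩q∣<∣p∣ {p = p} {q} ∣p∣≡∣q∣ p≢q = p⊆q⇒p≢q⇒∣p∣<∣q∣ (p∩q⊆p p q) p∩q≢p
  where
  p∩q≢p : p ∩ q ≢ p
  p∩q≢p p∩q≡p = p≢q (p⊆q⇒∣q∣≤∣p∣⇒p≡q (subst (_⊆ q) p∩q≡p (p∩q⊆q p q)) (≤-reflexive (sym ∣p∣≡∣q∣)))

⊆∩ : ∀ {n} {p q r : Subset n} → p ⊆ q → p ⊆ r → p ⊆ q ∩ r
⊆∩ p⊆q p⊆r x∈p = x∈p∩q⁺ (p⊆q x∈p , p⊆r x∈p)

∩-monoʳ-⊆ : ∀ {n} (p : Subset n) {q r} → q ⊆ r → p ∩ q ⊆ p ∩ r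
∩-monoʳ-⊆ p {q} q⊆r = ⊆∩ (p∩q⊆p p q) (⊆-trans (p∩q⊆q p q) q⊆r)

⊆⋃ : ∀ {n} {p : Subset n} {ps} → p ∈ ps → p ⊆ ⋃ ps
⊆⋃ {ps = p ∷ ps} (here refl)  = p⊆p∪q (⋃ ps)
⊆⋃ {ps = q ∷ ps} (there p∈ps) = ⊆-trans (⊆⋃ p∈ps) (q⊆p∪q q (⋃ ps))

∣⋃∣≤ : ∀ {n c} {ps : List (Subset n)} → All (λ p → ∣ p ∣ ≤ c) ps → ∣ ⋃ ps ∣ ≤ length ps * c
∣⋃∣≤ {n} []                         = ≤-reflexive (∣⊥∣≡0 n)
∣⋃∣≤ {ps = p ∷ ps} (∣p∣≤c ∷ ∣ps∣≤c) = ≤-trans (∣p∪q∣≤∣p∣+∣q∣ p (⋃ ps)) (+-mono-≤ ∣p∣≤c (∣⋃∣≤ ∣ps∣≤c))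

∣⋃tabulate∣≤ : ∀ {n ℓ c} (B : Fin ℓ → Subset n) → (∀ j → ∣ B j ∣ ≡ c) → ∣ ⋃ (tabulate B) ∣ ≤ ℓ * c
∣⋃tabulate∣≤ {c = c} B ∣B∣≡c =
  subst (λ m → ∣ ⋃ (tabulate B) ∣ ≤ m * c) (length-tabulate B) (∣⋃∣≤ (tabulate⁺ (≤-reflexive ∘ ∣B∣≡c)))

subsetsOf : ∀ {n} → Subset n → List (Subset n)
subsetsOf []            = [ [] ]
subsetsOf (outside ∷ p) = map (outside ∷_) (subsetsOf p)
subsetsOf (inside  ∷ p) = map (outside ∷_) (subsetsOf p) ++ map (inside ∷_) (subsetsOf p)

length-subsetsOf : ∀ {n} (p : Subset n) → length (subsetsOf p) ≡ 2 ^ ∣ p ∣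
length-subsetsOf []            = refl
length-subsetsOf (outside ∷ p) = trans (length-map _ (subsetsOf p)) (length-subsetsOf p)
length-subsetsOf (inside  ∷ p) = begin
  length (map (outside ∷_) ps ++ map (inside ∷_) ps)          ≡⟨ length-++ (map (outside ∷_) ps) ⟩
  length (map (outside ∷_) ps) + length (map (inside ∷_) ps)  ≡⟨ cong₂ _+_ ∣ps∣≡2^∣p∣ ∣ps∣≡2^∣p∣ ⟩
  2 ^ ∣ p ∣ + 2 ^ ∣ p ∣                                       ≡⟨ cong (2 ^ ∣ p ∣ +_) (+-identityʳ (2 ^ ∣ p ∣)) ⟨
  2 ^ suc ∣ p ∣                                               ∎
  where
  open ≡-Reasoning
  ps = subsetsOf p
  ∣ps∣≡2^∣p∣ : ∀ {b} → length (map (b ∷_) ps) ≡ 2 ^ ∣ p ∣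
  ∣ps∣≡2^∣p∣ = trans (length-map _ ps) (length-subsetsOf p)

⊆⇒∈subsetsOf : ∀ {n} {q p : Subset n} → q ⊆ p → q ∈ subsetsOf p
⊆⇒∈subsetsOf {q = []}          {[]}          _   = here refl
⊆⇒∈subsetsOf {q = outside ∷ q} {outside ∷ p} q⊆p = ∈-map⁺ (outside ∷_) (⊆⇒∈subsetsOf (drop-∷-⊆ q⊆p))
⊆⇒∈subsetsOf {q = inside  ∷ q} {outside ∷ p} q⊆p = ⊥-elim (inside∷p⊈outside∷q q⊆p)
⊆⇒∈subsetsOf {q = outside ∷ q} {inside  ∷ p} q⊆p =
  ∈-++⁺ˡ (∈-map⁺ (outside ∷_) (⊆⇒∈subsetsOf (drop-∷-⊆ q⊆p)))
⊆⇒∈subsetsOf {q = inside  ∷ q} {inside  ∷ p} q⊆p =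
  ∈-++⁺ʳ (map (outside ∷_) (subsetsOf p)) (∈-map⁺ (inside ∷_) (⊆⇒∈subsetsOf (drop-∷-⊆ q⊆p)))

⊆-ofSize : ∀ {n} s (p : Subset n) → s ≤ ∣ p ∣ → ∃[ q ] q ⊆ p × ∣ q ∣ ≡ s
⊆-ofSize {n} zero    p             _           = ∅ , ⊥⊆ , ∣⊥∣≡0 n
⊆-ofSize     (suc s) (outside ∷ p) s<∣p∣
  with q , q⊆p , ∣q∣≡s ← ⊆-ofSize (suc s) p s<∣p∣ = outside ∷ q , out⊆ q⊆p , ∣q∣≡s
⊆-ofSize     (suc s) (inside  ∷ p) (s≤s s≤∣p∣)
  with q , q⊆p , ∣q∣≡s ← ⊆-ofSize s p s≤∣p∣       = inside ∷ q , in⊆in q⊆p , cong suc ∣q∣≡s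

_≟ˢ_ : ∀ {n} → DecidableEquality (Subset n)
_≟ˢ_ = ≡-dec Bool._≟_

-- Duplicate-free lists

module _ {A : Set} where

  lookup-injective : ∀ {xs : List A} → Unique xs → Injective _≡_ _≡_ (lookup xs)
  lookup-injective (x∉xs ∷ _) {zero}  {zero}  _  = refl
  lookup-injective (x∉xs ∷ _) {zero}  {suc j} x≡ = contradiction x≡ (All.lookup x∉xs (∈-lookup j))
  lookup-injective (x∉xs ∷ _) {suc i} {zero}  ≡x = contradiction (sym ≡x) (All.lookup x∉xs (∈-lookup i))
  lookup-injective (_ ∷ u)    {suc i} {suc j} eq = cong suc (lookup-injective u eq)

  members : ∀ {ℓ} (xs : List A) → ℓ ≤ length xs → Fin ℓ → A
  members xs ℓ≤ i = lookup xs (inject≤ i ℓ≤)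

  members-injective : ∀ {ℓ} xs (ℓ≤ : ℓ ≤ length xs) → Unique xs → Injective _≡_ _≡_ (members xs ℓ≤)
  members-injective _ _ u eq = inject≤-injective _ _ _ _ (lookup-injective u eq)

  members-∈ : ∀ {ℓ} xs (ℓ≤ : ℓ ≤ length xs) i → members xs ℓ≤ i ∈ xs
  members-∈ _ _ i = ∈-lookup (inject≤ i _)

  module _ {P : Pred A 0ℓ} (P? : Decidable P) where

    length-filter-∁ : ∀ xs → length xs ≡ length (filter P? xs) + length (filter (∁? P?) xs)
    length-filter-∁ []       = refl
    length-filter-∁ (x ∷ xs) with P? x
    ... | yes _ = cong suc (length-filter-∁ xs)
    ... | no  _ = trans (cong suc (length-filter-∁ xs)) (sym (+-suc _ _))

    length-filter≤-split : ∀ {Q : Pred A 0ℓ} (Q? : Decidable Q) xs →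
      length (filter P? xs) ≤ length (filter Q? xs) + length (filter (P? ∩? ∁? Q?) xs)
    length-filter≤-split Q? []       = z≤n
    length-filter≤-split Q? (x ∷ xs) with P? x | Q? x
    ... | yes _ | yes _ = s≤s (length-filter≤-split Q? xs)
    ... | yes _ | no  _ = ≤-trans (s≤s (length-filter≤-split Q? xs)) (≤-reflexive (sym (+-suc _ _)))
    ... | no  _ | yes _ = m≤n⇒m≤1+n (length-filter≤-split Q? xs)
    ... | no  _ | no  _ = length-filter≤-split Q? xs

    length-filter< : ∀ {ℓ xs} → Unique xs →
      (∀ (f : Fin ℓ → A) → Injective _≡_ _≡_ f → (∀ i → f i ∈ xs) → (∀ i → P (f i)) → ⊥) →
      length (filter P? xs) < ℓ
    length-filter< {ℓ} {xs} u no-distinct with ℓ ≤? length (filter P? xs)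
    ... | no  ℓ≰ = ≰⇒> ℓ≰
    ... | yes ℓ≤ = ⊥-elim (no-distinct (members Ps ℓ≤) (members-injective Ps ℓ≤ (Unique-filter⁺ P? u))
                                       (proj₁ ∘ ∈-filter⁻ P? ∘ members-∈ Ps ℓ≤)
                                       (proj₂ ∘ ∈-filter⁻ P? {xs = xs} ∘ members-∈ Ps ℓ≤))
      where Ps = filter P? xs

  length-filter≤cover : ∀ {B : Set} {P : Pred A 0ℓ} (P? : Decidable P) {Q : B → Pred A 0ℓ}
    (Q? : ∀ b → Decidable (Q b)) (bs : List B) {xs c} →
    (∀ {x} → x ∈ xs → P x → Any (λ b → Q b x) bs) → (∀ {b} → b ∈ bs → length (filter (Q? b) xs) ≤ c) →
    length (filter P? xs) ≤ length bs * c
  length-filter≤cover P? Q? [] cover _ =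
    ≤-reflexive (cong length (filter-none P? (All.tabulate λ x∈xs Px → ¬Any[] (cover x∈xs Px))))
  length-filter≤cover {P = P} P? {Q} Q? (b ∷ bs) {xs} {c} cover Qb≤c = begin
    length (filter P? xs)                                              ≤⟨ length-filter≤-split P? (Q? b) xs ⟩
    length (filter (Q? b) xs) + length (filter (P? ∩? ∁? (Q? b)) xs)  ≤⟨ +-mono-≤ (Qb≤c (here refl))
                                                     (length-filter≤cover _ Q? bs cover′ (Qb≤c ∘ there)) ⟩
    c + length bs * c                                                  ∎
    where
    open ≤-Reasoning
    cover′ : ∀ {x} → x ∈ xs → P x × ¬ Q b x → Any (λ b → Q b x) bs
    cover′ x∈xs (Px , ¬Qbx) with cover x∈xs Px
    ... | here Qbx     = contradiction Qbx ¬Qbx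
    ... | there Q[bs]x = Q[bs]x

  module _ (_≟ᴬ_ : DecidableEquality A) where

    length≡1+length-filter-≢ : ∀ {x xs} → Unique xs → x ∈ xs →
      length xs ≡ suc (length (filter (λ y → ¬? (y ≟ᴬ x)) xs))
    length≡1+length-filter-≢ {xs = y ∷ xs} (y∉xs ∷ _) (here refl) with y ≟ᴬ y
    ... | yes _  = cong (suc ∘ length) (sym (filter-all _ (All.map (λ y≢z z≡y → y≢z (sym z≡y)) y∉xs)))
    ... | no y≢y = contradiction refl y≢y
    length≡1+length-filter-≢ {x} {y ∷ xs} (y∉xs ∷ u) (there x∈xs) with y ≟ᴬ x
    ... | yes refl = contradiction refl (All.lookup y∉xs x∈xs)
    ... | no _     = cong suc (length≡1+length-filter-≢ u x∈xs)

    distinct-members-through : ∀ {ℓ x xs} → Unique xs → x ∈ xs → suc ℓ ≤ length xs →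
      Σ (Fin (suc ℓ) → A) λ f → Injective _≡_ _≡_ f × (∀ i → f i ∈ xs) × f zero ≡ x
    distinct-members-through {ℓ} {x} {xs} u x∈xs ℓ<∣xs∣ =
      members ys ℓ≤∣ys∣ , members-injective ys ℓ≤∣ys∣ u-ys , ∈xs ∘ members-∈ ys ℓ≤∣ys∣ , refl
      where
      ys = x ∷ filter (λ y → ¬? (y ≟ᴬ x)) xs

      u-ys : Unique ys
      u-ys = All.map (λ y≢x x≡y → y≢x (sym x≡y)) (all-filter _ xs) ∷ Unique-filter⁺ _ u

      ℓ≤∣ys∣ : suc ℓ ≤ length ys
      ℓ≤∣ys∣ = subst (suc ℓ ≤_) (length≡1+length-filter-≢ u x∈xs) ℓ<∣xs∣

      ∈xs : ∀ {y} → y ∈ ys → y ∈ xs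
      ∈xs (here refl)  = x∈xs
      ∈xs (there y∈ys) = proj₁ (∈-filter⁻ _ y∈ys)

All-impossible⇒length≡0 : ∀ {A : Set} {P : A → Set} {xs} → (∀ {x} → ¬ P x) → All P xs → length xs ≡ 0
All-impossible⇒length≡0 ¬P []       = refl
All-impossible⇒length≡0 ¬P (Px ∷ _) = contradiction Px ¬P

-- The star bound

tailsWith : ∀ {n} → Bool → List (Subset (suc n)) → List (Subset n)
tailsWith b []             = []
tailsWith b ((c ∷ p) ∷ xs) with b Bool.≟ c
... | yes _ = p ∷ tailsWith b xs
... | no  _ = tailsWith b xs

∈-tailsWith⁻ : ∀ {n b} {p : Subset n} xs → p ∈ tailsWith b xs → (b ∷ p) ∈ xs
∈-tailsWith⁻ {b = b} ((c ∷ q) ∷ xs) p∈ with b Bool.≟ c | p∈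
... | yes refl | here refl = here refl
... | yes refl | there p∈′ = there (∈-tailsWith⁻ xs p∈′)
... | no  _    | p∈′       = there (∈-tailsWith⁻ xs p∈′)

tailsWith⁺ : ∀ {n b} {P : Subset (suc n) → Set} {xs} → All P xs → All (P ∘ (b ∷_)) (tailsWith b xs)
tailsWith⁺ {xs = xs} Pxs = All.tabulate (All.lookup Pxs ∘ ∈-tailsWith⁻ xs)

Unique-tailsWith : ∀ {n b} {xs : List (Subset (suc n))} → Unique xs → Unique (tailsWith b xs)
Unique-tailsWith {xs = []} [] = []
Unique-tailsWith {b = b} {(c ∷ q) ∷ xs} (c∷q∉xs ∷ u) with b Bool.≟ c
... | yes refl = All.tabulate (λ p∈ q≡p → All.lookup c∷q∉xs (∈-tailsWith⁻ xs p∈) (cong (b ∷_) q≡p))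
               ∷ Unique-tailsWith u
... | no  _    = Unique-tailsWith u

length-tailsWith : ∀ {n} (xs : List (Subset (suc n))) →
  length xs ≡ length (tailsWith inside xs) + length (tailsWith outside xs)
length-tailsWith []                   = refl
length-tailsWith ((inside  ∷ p) ∷ xs) = cong suc (length-tailsWith xs)
length-tailsWith ((outside ∷ p) ∷ xs) = trans (cong suc (length-tailsWith xs)) (sym (+-suc _ _))

Unique⇒length≤1 : ∀ {xs : List (Subset 0)} → Unique xs → length xs ≤ 1
Unique⇒length≤1 {[]}          _               = z≤n
Unique⇒length≤1 {[] ∷ []}     _               = s≤s z≤n
Unique⇒length≤1 {[] ∷ [] ∷ _} ((≢[] ∷ _) ∷ _) = contradiction refl ≢[]

-- Sizes are written ∣ S ∣ + j so that the recursion on n needs no truncated subtraction.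
star-bound : ∀ {n j} (S : Subset n) {xs : List (Subset n)} → Unique xs →
  All (λ A → ∣ A ∣ ≡ ∣ S ∣ + j) xs → All (S ⊆_) xs → length xs ≤ (n ∸ ∣ S ∣) C j
star-bound {zero}  {zero}  [] u _ _ = Unique⇒length≤1 u
star-bound {zero}  {suc j} [] {[]}     _ _        _ = z≤n
star-bound {zero}  {suc j} [] {[] ∷ _} _ (() ∷ _) _
star-bound {suc n} {j}     (inside ∷ S) {xs} u sizes S⊆ = begin
  length xs                       ≡⟨ length-tailsWith xs ⟩
  length ins + length outs        ≡⟨ cong (length ins +_) (All-impossible⇒length≡0 inside∷p⊈outside∷q (tailsWith⁺ S⊆)) ⟩
  length ins + 0                  ≡⟨ +-identityʳ _ ⟩
  length ins                      ≤⟨ star-bound S (Unique-tailsWith u) (All.map suc-injective (tailsWith⁺ sizes))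
                                                  (All.map drop-∷-⊆ (tailsWith⁺ S⊆)) ⟩
  (n ∸ ∣ S ∣) C j                 ∎
  where
  open ≤-Reasoning
  ins = tailsWith inside xs
  outs = tailsWith outside xs
star-bound {suc n} {zero}  (outside ∷ S) {xs} u sizes S⊆ = begin
  length xs                       ≡⟨ length-tailsWith xs ⟩
  length ins + length outs        ≡⟨ cong (_+ length outs) (All-impossible⇒length≡0 too-small
                                                             (All.zip (tailsWith⁺ sizes , tailsWith⁺ S⊆))) ⟩
  length outs                     ≤⟨ star-bound S (Unique-tailsWith u) (tailsWith⁺ sizes) (All.map drop-∷-⊆ (tailsWith⁺ S⊆)) ⟩
  1                               ∎
  where
  open ≤-Reasoning
  ins = tailsWith inside xs
  outs = tailsWith outside xs
  too-small : ∀ {p} → ¬ (suc ∣ p ∣ ≡ ∣ S ∣ + 0 × outside ∷ S ⊆ inside ∷ p)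
  too-small (∣p∣<∣S∣ , S⊆p) = <⇒≱ (≤-reflexive (trans ∣p∣<∣S∣ (+-identityʳ _))) (p⊆q⇒∣p∣≤∣q∣ (drop-∷-⊆ S⊆p))
star-bound {suc n} {suc j} (outside ∷ S) {xs} u sizes S⊆ = begin
  length xs                              ≡⟨ length-tailsWith xs ⟩
  length ins + length outs               ≤⟨ +-mono-≤ ins≤ outs≤ ⟩
  (n ∸ ∣ S ∣) C j + (n ∸ ∣ S ∣) C suc j  ≡⟨ nCk+nC[k+1]≡[n+1]C[k+1] (n ∸ ∣ S ∣) j ⟩
  suc (n ∸ ∣ S ∣) C suc j                ≡⟨ cong (_C suc j) (+-∸-assoc 1 (∣p∣≤n S)) ⟨
  (suc n ∸ ∣ S ∣) C suc j                ∎
  where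
  open ≤-Reasoning
  ins = tailsWith inside xs
  outs = tailsWith outside xs
  ins≤ : length ins ≤ (n ∸ ∣ S ∣) C j
  ins≤ = star-bound S (Unique-tailsWith u) (All.map (λ e → suc-injective (trans e (+-suc _ j))) (tailsWith⁺ sizes))
                      (All.map drop-∷-⊆ (tailsWith⁺ S⊆))
  outs≤ : length outs ≤ (n ∸ ∣ S ∣) C suc j
  outs≤ = star-bound S (Unique-tailsWith u) (tailsWith⁺ sizes) (All.map drop-∷-⊆ (tailsWith⁺ S⊆))

star-bound-uniform : ∀ {n k t} {xs : List (Subset n)} (T : Subset n) → Unique xs → All (λ A → ∣ A ∣ ≡ k) xs →
  ∣ T ∣ ≡ t → t ≤ k → All (T ⊆_) xs → length xs ≤ (n ∸ t) C (k ∸ t)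
star-bound-uniform T u sizes refl t≤k = star-bound T u (All.map (λ e → trans e (sym (m+[n∸m]≡n t≤k))) sizes)

degree : ∀ {n} → Subset n → List (Subset n) → ℕ
degree T xs = length (filter (T ⊆?_) xs)

module _ {n k : ℕ} {xs : List (Subset n)} (u : Unique xs) (sizes : All (λ A → ∣ A ∣ ≡ k) xs) where

  degree≤C : ∀ {t} (T : Subset n) → ∣ T ∣ ≡ t → t ≤ k → degree T xs ≤ (n ∸ t) C (k ∸ t)
  degree≤C T ∣T∣≡t t≤k =
    star-bound-uniform T (Unique-filter⁺ _ u) (All-filter⁺ _ sizes) ∣T∣≡t t≤k (all-filter _ xs)

  degree≤C⁻ : ∀ {t} (S : Subset n) → ∣ S ∣ ≡ suc t → t ≤ k → degree S xs ≤ (n ∸ suc t) C⁻ (k ∸ t)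
  degree≤C⁻ {t} S ∣S∣≡ t≤k with k ∸ t in k∸t≡
  ... | zero  = ≤-reflexive (All-impossible⇒length≡0 too-small (All.zip (All-filter⁺ _ sizes , all-filter _ xs)))
    where
    too-small : ∀ {A} → ¬ (∣ A ∣ ≡ k × S ⊆ A)
    too-small (∣A∣≡k , S⊆A) = <⇒≱ (s≤s (m∸n≡0⇒m≤n k∸t≡)) (subst₂ _≤_ ∣S∣≡ ∣A∣≡k (p⊆q⇒∣p∣≤∣q∣ S⊆A))
  ... | suc p = subst (λ s → degree S xs ≤ (n ∸ s) C p) ∣S∣≡
                  (star-bound S (Unique-filter⁺ _ u) (All.map (λ e → trans e k≡∣S∣+p) (All-filter⁺ _ sizes))
                              (all-filter _ xs))
    where
    k≡∣S∣+p : k ≡ ∣ S ∣ + p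
    k≡∣S∣+p = begin
      k            ≡⟨ m+[n∸m]≡n t≤k ⟨
      t + (k ∸ t)  ≡⟨ cong (t +_) k∸t≡ ⟩
      t + suc p    ≡⟨ +-suc t p ⟩
      suc t + p    ≡⟨ cong (_+ p) ∣S∣≡ ⟨
      ∣ S ∣ + p    ∎
      where open ≡-Reasoning

length≤thin+2^∣V∣*c : ∀ {n} s (V : Subset n) (xs : List (Subset n)) c → (∀ T → ∣ T ∣ ≡ s → degree T xs ≤ c) →
  length xs ≤ length (filter (λ A → ¬? (s ≤? ∣ A ∩ V ∣)) xs) + 2 ^ ∣ V ∣ * c
length≤thin+2^∣V∣*c s V xs c degree≤c = begin
  length xs                                         ≡⟨ length-filter-∁ (λ A → s ≤? ∣ A ∩ V ∣) xs ⟩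
  length (filter (λ A → s ≤? ∣ A ∩ V ∣) xs) + thin  ≤⟨ +-monoˡ-≤ thin (length-filter≤cover _ (λ T → T ⊆?_) Ts cover Ts-degree≤c) ⟩
  length Ts * c + thin                              ≤⟨ +-monoˡ-≤ thin (*-monoˡ-≤ c ∣Ts∣≤2^∣V∣) ⟩
  2 ^ ∣ V ∣ * c + thin                              ≡⟨ +-comm (2 ^ ∣ V ∣ * c) thin ⟩
  thin + 2 ^ ∣ V ∣ * c                              ∎
  where
  open ≤-Reasoning
  thin = length (filter (λ A → ¬? (s ≤? ∣ A ∩ V ∣)) xs)
  Ts = filter (λ T → ∣ T ∣ ≟ s) (subsetsOf V)

  ∣Ts∣≤2^∣V∣ : length Ts ≤ 2 ^ ∣ V ∣
  ∣Ts∣≤2^∣V∣ = ≤-trans (length-filter _ (subsetsOf V)) (≤-reflexive (length-subsetsOf V))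

  Ts-degree≤c : ∀ {T} → T ∈ Ts → degree T xs ≤ c
  Ts-degree≤c T∈Ts = degree≤c _ (proj₂ (∈-filter⁻ (λ T → ∣ T ∣ ≟ s) {xs = subsetsOf V} T∈Ts))

  cover : ∀ {A} → A ∈ xs → s ≤ ∣ A ∩ V ∣ → Any (_⊆ A) Ts
  cover {A} _ s≤∣A∩V∣ with T , T⊆A∩V , ∣T∣≡s ← ⊆-ofSize s (A ∩ V) s≤∣A∩V∣ =
    lose (∈-filter⁺ _ (⊆⇒∈subsetsOf (⊆-trans T⊆A∩V (p∩q⊆q A V))) ∣T∣≡s) (⊆-trans T⊆A∩V (p∩q⊆p A V))

-- Weakly cross intersecting families

weakly-sym : ∀ {n ℓ t} {𝓕 𝓕′ : List (Subset n)} →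
  WeaklyCrossIntersecting ℓ t 𝓕 𝓕′ → WeaklyCrossIntersecting ℓ t 𝓕′ 𝓕
weakly-sym {ℓ = ℓ} {t} W F′ F dF′ dF = begin
  ℓ * ℓ * t ∸ ℓ + 1                    ≤⟨ W F F′ dF dF′ ⟩
  ∑ (λ i → ∑ (λ j → ∣ F i ∩ F′ j ∣))  ≡⟨ ∑-swap (λ i j → ∣ F i ∩ F′ j ∣) ⟩
  ∑ (λ j → ∑ (λ i → ∣ F i ∩ F′ j ∣))  ≤⟨ ∑-mono-≤ (λ j → ∑-mono-≤ (λ i → ≤-reflexive (cong ∣_∣ (∩-comm (F i) (F′ j))))) ⟩
  ∑ (λ j → ∑ (λ i → ∣ F′ j ∩ F i ∣))  ∎
  where open ≤-Reasoning

¬weakly : ∀ {n ℓ t} {𝓕 𝓕′ : List (Subset n)} (F F′ : Fin ℓ → Subset n) →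
  DistinctMembers ℓ 𝓕 F → DistinctMembers ℓ 𝓕′ F′ →
  (∀ i → ∑ (λ j → ∣ F i ∩ F′ j ∣) < ℓ * t) → ¬ WeaklyCrossIntersecting ℓ t 𝓕 𝓕′
¬weakly {ℓ = ℓ} {t} F F′ dF dF′ rows< W = m+1+n≰m (ℓ * ℓ * t ∸ ℓ) (begin
  ℓ * ℓ * t ∸ ℓ + 1                    ≤⟨ W F F′ dF dF′ ⟩
  ∑ (λ i → ∑ (λ j → ∣ F i ∩ F′ j ∣))  ≤⟨ ∑-mono-≤ (λ i → <⇒≤pred (rows< i)) ⟩
  ∑ {ℓ} (λ _ → pred (ℓ * t))           ≡⟨ ∑-const ℓ (pred (ℓ * t)) ⟩
  ℓ * pred (ℓ * t)                     ≡⟨ cong (ℓ *_) (pred[m∸n]≡m∸[1+n] (ℓ * t) 0) ⟩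
  ℓ * (ℓ * t ∸ 1)                      ≡⟨ *-distribˡ-∸ ℓ (ℓ * t) 1 ⟩
  ℓ * (ℓ * t) ∸ ℓ * 1                  ≡⟨ cong₂ _∸_ (sym (*-assoc ℓ ℓ t)) (*-identityʳ ℓ) ⟩
  ℓ * ℓ * t ∸ ℓ                        ∎)
  where open ≤-Reasoning

thin-trace⇒row< : ∀ {n ℓ t} {T F V : Subset n} (B : Fin (suc ℓ) → Subset n) → ∣ T ∣ ≡ t → T ⊆ F → T ⊆ V →
  (∀ j → B j ⊆ V) → ¬ T ⊆ B zero → ∣ F ∩ V ∣ ≤ t → ∑ (λ j → ∣ F ∩ B j ∣) < suc ℓ * t
thin-trace⇒row< {t = t} {T} {F} {V} B ∣T∣≡t T⊆F T⊆V B⊆V T⊈B₀ ∣F∩V∣≤t = ∑-< entry≤ zero entry₀<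
  where
  T≡F∩V : T ≡ F ∩ V
  T≡F∩V = p⊆q⇒∣q∣≤∣p∣⇒p≡q (⊆∩ T⊆F T⊆V) (subst (∣ F ∩ V ∣ ≤_) (sym ∣T∣≡t) ∣F∩V∣≤t)

  entry≤ : ∀ j → ∣ F ∩ B j ∣ ≤ t
  entry≤ j = ≤-trans (p⊆q⇒∣p∣≤∣q∣ (∩-monoʳ-⊆ F (B⊆V j))) ∣F∩V∣≤t

  F∩B₀⊆T : F ∩ B zero ⊆ T
  F∩B₀⊆T = subst (F ∩ B zero ⊆_) (sym T≡F∩V) (∩-monoʳ-⊆ F (B⊆V zero))

  F∩B₀≢T : F ∩ B zero ≢ T
  F∩B₀≢T F∩B₀≡T = T⊈B₀ (subst (_⊆ B zero) F∩B₀≡T (p∩q⊆q F (B zero)))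

  entry₀< : ∣ F ∩ B zero ∣ < t
  entry₀< = subst (∣ F ∩ B zero ∣ <_) ∣T∣≡t (p⊆q⇒p≢q⇒∣p∣<∣q∣ F∩B₀⊆T F∩B₀≢T)

weakly⇒t≤k : ∀ {n ℓ′ t k k′} {𝓕 𝓖 : List (Subset n)} → UniformFamily n k 𝓕 → UniformFamily n k′ 𝓖 →
  suc ℓ′ ≤ length 𝓕 → suc ℓ′ ≤ length 𝓖 → WeaklyCrossIntersecting (suc ℓ′) t 𝓕 𝓖 → t ≤ k
weakly⇒t≤k {t = t} {k} {𝓕 = 𝓕} {𝓖} 𝓕-uniform 𝓖-uniform ℓ≤∣𝓕∣ ℓ≤∣𝓖∣ W with t ≤? k
... | yes t≤k = t≤k
... | no  t≰k = contradiction W (¬weakly {t = t} F G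
                  (members-injective 𝓕 ℓ≤∣𝓕∣ (distinct 𝓕-uniform) , members-∈ 𝓕 ℓ≤∣𝓕∣)
                  (members-injective 𝓖 ℓ≤∣𝓖∣ (distinct 𝓖-uniform) , members-∈ 𝓖 ℓ≤∣𝓖∣)
                  (λ i → ∑-< (<⇒≤ ∘ entry< i) zero (entry< i zero)))
  where
  open UniformFamily
  F = members 𝓕 ℓ≤∣𝓕∣
  G = members 𝓖 ℓ≤∣𝓖∣
  entry< : ∀ i j → ∣ F i ∩ G j ∣ < t
  entry< i j = ≤-<-trans (∣p∩q∣≤∣p∣ (F i) (G j)) (subst (_< t) (sym ∣Fi∣≡k) (≰⇒> t≰k))
    where ∣Fi∣≡k = All.lookup (uniform 𝓕-uniform) (members-∈ 𝓕 ℓ≤∣𝓕∣ i)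

weakly-t-uniform⇒ℓ≡1 : ∀ {n ℓ′ t} {𝓕 𝓖 : List (Subset n)} → UniformFamily n t 𝓕 → UniformFamily n t 𝓖 →
  suc ℓ′ ≤ length 𝓕 → suc ℓ′ ≤ length 𝓖 → WeaklyCrossIntersecting (suc ℓ′) t 𝓕 𝓖 → suc ℓ′ ≡ 1
weakly-t-uniform⇒ℓ≡1 {ℓ′ = zero} _ _ _ _ _ = refl
weakly-t-uniform⇒ℓ≡1 {ℓ′ = suc ℓ″} {t} {𝓕} {𝓖} 𝓕-uniform 𝓖-uniform ℓ≤∣𝓕∣ ℓ≤∣𝓖∣ W =
  contradiction W (¬weakly {t = t} F G (members-injective 𝓕 ℓ≤∣𝓕∣ (distinct 𝓕-uniform) , F∈𝓕) (G-injective , G∈𝓖) row<)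
  where
  open UniformFamily
  F = members 𝓕 ℓ≤∣𝓕∣
  G = members 𝓖 ℓ≤∣𝓖∣
  F∈𝓕 = members-∈ 𝓕 ℓ≤∣𝓕∣
  G∈𝓖 = members-∈ 𝓖 ℓ≤∣𝓖∣
  G-injective = members-injective 𝓖 ℓ≤∣𝓖∣ (distinct 𝓖-uniform)

  ∣F∣≡t : ∀ i → ∣ F i ∣ ≡ t
  ∣F∣≡t = All.lookup (uniform 𝓕-uniform) ∘ F∈𝓕

  ∣G∣≡t : ∀ j → ∣ G j ∣ ≡ t
  ∣G∣≡t = All.lookup (uniform 𝓖-uniform) ∘ G∈𝓖

  entry≤ : ∀ i j → ∣ F i ∩ G j ∣ ≤ t
  entry≤ i j = ≤-trans (∣p∩q∣≤∣p∣ (F i) (G j)) (≤-reflexive (∣F∣≡t i))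

  ≢⇒entry< : ∀ i j → F i ≢ G j → ∣ F i ∩ G j ∣ < t
  ≢⇒entry< i j Fi≢Gj =
    subst (∣ F i ∩ G j ∣ <_) (∣F∣≡t i) (∣p∣≡∣q∣⇒p≢q⇒∣p∩q∣<∣p∣ (trans (∣F∣≡t i) (sym (∣G∣≡t j))) Fi≢Gj)

  row< : ∀ i → ∑ (λ j → ∣ F i ∩ G j ∣) < suc (suc ℓ″) * t
  row< i with F i ≟ˢ G zero
  ... | no  Fi≢G₀ = ∑-< (entry≤ i) zero (≢⇒entry< i zero Fi≢G₀)
  ... | yes Fi≡G₀ = ∑-< (entry≤ i) (suc zero)
                      (≢⇒entry< i (suc zero) (λ Fi≡G₁ → 0≢1 (G-injective (trans (sym Fi≡G₀) Fi≡G₁))))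
    where
    0≢1 : zero ≢ suc zero
    0≢1 ()

module Side {n} (ℓ′ t k k′ K : ℕ) {𝓕 𝓖 : List (Subset n)}
  (𝓕-uniform : UniformFamily n k 𝓕) (𝓖-uniform : UniformFamily n k′ 𝓖) (ℓ≤∣𝓖∣ : suc ℓ′ ≤ length 𝓖)
  (W : WeaklyCrossIntersecting (suc ℓ′) t 𝓕 𝓖) (t≤k : t ≤ k) (K-large : 2 ^ (t + suc ℓ′ * k′) ≤ K) where

  open UniformFamily

  ℓ X E : ℕ
  ℓ = suc ℓ′
  X = (n ∸ t) C (k ∸ t)
  E = (n ∸ suc t) C⁻ (k ∸ t)

  B : Fin ℓ → Subset n
  B = members 𝓖 ℓ≤∣𝓖∣

  U : Subset n
  U = ⋃ (tabulate B)

  ∣⋃members∣≤ : (B′ : Fin ℓ → Subset n) → (∀ j → B′ j ∈ 𝓖) → ∣ ⋃ (tabulate B′) ∣ ≤ ℓ * k′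
  ∣⋃members∣≤ B′ B′∈𝓖 = ∣⋃tabulate∣≤ B′ (All.lookup (uniform 𝓖-uniform) ∘ B′∈𝓖)

  few-miss-U : length (filter (λ F → ¬? (t ≤? ∣ F ∩ U ∣)) 𝓕) < ℓ
  few-miss-U = length-filter< _ (distinct 𝓕-uniform) λ F F-injective F∈𝓕 misses →
    ¬weakly F B (F-injective , F∈𝓕) (members-injective 𝓖 ℓ≤∣𝓖∣ (distinct 𝓖-uniform) , members-∈ 𝓖 ℓ≤∣𝓖∣)
      (λ i → ∑-< (<⇒≤ ∘ entry< {F} misses i) zero (entry< {F} misses i zero)) W
    where
    entry< : ∀ {F : Fin ℓ → Subset n} → (∀ i → ¬ t ≤ ∣ F i ∩ U ∣) → ∀ i j → ∣ F i ∩ B j ∣ < t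
    entry< {F} misses i j =
      ≤-<-trans (p⊆q⇒∣p∣≤∣q∣ (∩-monoʳ-⊆ (F i) (⊆⋃ (∈-tabulate⁺ {f = B} j)))) (≰⇒> (misses i))

  length≤ℓ′+K*c : ∀ s (V : Subset n) (xs : List (Subset n)) c → (∀ T → ∣ T ∣ ≡ s → degree T xs ≤ c) →
    length (filter (λ A → ¬? (s ≤? ∣ A ∩ V ∣)) xs) < ℓ → 2 ^ ∣ V ∣ ≤ K → length xs ≤ ℓ′ + K * c
  length≤ℓ′+K*c s V xs c degree≤c few-thin 2^∣V∣≤K =
    ≤-trans (length≤thin+2^∣V∣*c s V xs c degree≤c) (+-mono-≤ (≤-pred few-thin) (*-monoˡ-≤ c 2^∣V∣≤K))

  degrees≤⇒length≤ : ∀ c → (∀ T → ∣ T ∣ ≡ t → degree T 𝓕 ≤ c) → length 𝓕 ≤ ℓ′ + K * c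
  degrees≤⇒length≤ c degree≤c = length≤ℓ′+K*c t U 𝓕 c degree≤c few-miss-U
    (≤-trans (^-monoʳ-≤ 2 (≤-trans (∣⋃members∣≤ B (members-∈ 𝓖 ℓ≤∣𝓖∣)) (m≤n+m _ t))) K-large)

  length≤ℓ′+K*X : length 𝓕 ≤ ℓ′ + K * X
  length≤ℓ′+K*X = degrees≤⇒length≤ X (λ T ∣T∣≡t → degree≤C (distinct 𝓕-uniform) (uniform 𝓕-uniform) T ∣T∣≡t t≤k)

  ⊈⇒degree≤ : ∀ {T B₀} → ∣ T ∣ ≡ t → B₀ ∈ 𝓖 → ¬ T ⊆ B₀ → degree T 𝓕 ≤ ℓ′ + K * E
  ⊈⇒degree≤ {T} {B₀} ∣T∣≡t B₀∈𝓖 T⊈B₀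
    with B′ , B′-injective , B′∈𝓖 , B′₀≡B₀ ← distinct-members-through _≟ˢ_ (distinct 𝓖-uniform) B₀∈𝓖 ℓ≤∣𝓖∣ =
    length≤ℓ′+K*c (suc t) V 𝓕ᵀ E degree≤E few-thin 2^∣V∣≤K
    where
    V = T ∪ ⋃ (tabulate B′)
    𝓕ᵀ = filter (T ⊆?_) 𝓕

    B′⊆V : ∀ j → B′ j ⊆ V
    B′⊆V j = ⊆-trans (⊆⋃ (∈-tabulate⁺ {f = B′} j)) (q⊆p∪q T _)

    2^∣V∣≤K : 2 ^ ∣ V ∣ ≤ K
    2^∣V∣≤K = ≤-trans (^-monoʳ-≤ 2 (≤-trans (∣p∪q∣≤∣p∣+∣q∣ T _) (+-mono-≤ (≤-reflexive ∣T∣≡t) (∣⋃members∣≤ B′ B′∈𝓖))))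
                      K-large

    degree≤E : ∀ S → ∣ S ∣ ≡ suc t → degree S 𝓕ᵀ ≤ E
    degree≤E S ∣S∣≡ = degree≤C⁻ (Unique-filter⁺ _ (distinct 𝓕-uniform)) (All-filter⁺ _ (uniform 𝓕-uniform)) S ∣S∣≡ t≤k

    few-thin : length (filter (λ F → ¬? (suc t ≤? ∣ F ∩ V ∣)) 𝓕ᵀ) < ℓ
    few-thin = length-filter< _ (Unique-filter⁺ _ (distinct 𝓕-uniform)) λ F F-injective F∈𝓕ᵀ thin →
      ¬weakly F B′ (F-injective , proj₁ ∘ ∈-filter⁻ _ ∘ F∈𝓕ᵀ) (B′-injective , B′∈𝓖)
        (λ i → thin-trace⇒row< B′ ∣T∣≡t (proj₂ (∈-filter⁻ (T ⊆?_) {xs = 𝓕} (F∈𝓕ᵀ i))) (p⊆p∪q _) B′⊆V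
                                (T⊈B₀ ∘ subst (T ⊆_) B′₀≡B₀) (≤-pred (≰⇒> (thin i)))) W

  heavy⇒⊆ : ∀ {T} → ∣ T ∣ ≡ t → ℓ + K * E ≤ degree T 𝓕 → ∀ {B₀} → B₀ ∈ 𝓖 → T ⊆ B₀
  heavy⇒⊆ {T} ∣T∣≡t heavy {B₀} B₀∈𝓖 with T ⊆? B₀
  ... | yes T⊆B₀ = T⊆B₀
  ... | no  T⊈B₀ = contradiction (⊈⇒degree≤ ∣T∣≡t B₀∈𝓖 T⊈B₀) (<⇒≱ heavy)

module TwoSided {n} (ℓ′ t k k′ K : ℕ) {𝓕 𝓖 : List (Subset n)}
  (𝓕-uniform : UniformFamily n k 𝓕) (𝓖-uniform : UniformFamily n k′ 𝓖)
  (ℓ≤∣𝓕∣ : suc ℓ′ ≤ length 𝓕) (ℓ≤∣𝓖∣ : suc ℓ′ ≤ length 𝓖) (W : WeaklyCrossIntersecting (suc ℓ′) t 𝓕 𝓖)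
  (t≤k : t ≤ k) (t≤k′ : t ≤ k′) (K-large : 2 ^ (t + suc ℓ′ * k′) ≤ K) (K-large′ : 2 ^ (t + suc ℓ′ * k) ≤ K)
  (n-large  : t + Thresholds.L ℓ′ K * Thresholds.L ℓ′ K * k ≤ n)
  (n-large′ : t + Thresholds.L ℓ′ K * Thresholds.L ℓ′ K * k′ ≤ n)
  where

  open UniformFamily
  open Thresholds ℓ′ K
  module 𝓕ˢ = Side ℓ′ t k k′ K 𝓕-uniform 𝓖-uniform ℓ≤∣𝓖∣ W t≤k K-large
  module 𝓖ˢ = Side ℓ′ t k′ k K 𝓖-uniform 𝓕-uniform ℓ≤∣𝓕∣ (weakly-sym {t = t} W) t≤k′ K-large′
  module 𝓕ᵇ = Binomials L t k n (s≤s z≤n) n-large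
  module 𝓖ᵇ = Binomials L t k′ n (s≤s z≤n) n-large′

  0<K : 0 < K
  0<K = ≤-trans (m^n>0 2 (t + suc ℓ′ * k′)) K-large

  ℓ′+K*E≡ℓ′ : ∀ {E} → E ≡ 0 → ℓ′ + K * E ≡ ℓ′
  ℓ′+K*E≡ℓ′ refl = trans (cong (ℓ′ +_) (*-zeroʳ K)) (+-identityʳ ℓ′)

  data Outcome : Set where
    common-core : ∀ T → ∣ T ∣ ≡ t → All (T ⊆_) 𝓕 → All (T ⊆_) 𝓖 → Outcome
    𝓖-small     : length 𝓖 ≤ ℓ′ + K * 𝓖ˢ.E → Outcome
    𝓕-small     : length 𝓕 ≤ ℓ′ + K * (ℓ′ + K * 𝓕ˢ.E) → Outcome

  outcome : Outcome
  outcome with anySubset? (λ T → (∣ T ∣ ≟ t) ×-dec (suc ℓ′ + K * 𝓕ˢ.E ≤? degree T 𝓕))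
  ... | no no-𝓕-heavy =
    𝓕-small (𝓕ˢ.degrees≤⇒length≤ _ λ T ∣T∣≡t → ≤-pred (≰⇒> λ heavy → no-𝓕-heavy (T , ∣T∣≡t , heavy)))
  ... | yes (T , ∣T∣≡t , 𝓕-heavy) with suc ℓ′ + K * 𝓖ˢ.E ≤? degree T 𝓖
  ...   | yes 𝓖-heavy = common-core T ∣T∣≡t (All.tabulate (𝓖ˢ.heavy⇒⊆ ∣T∣≡t 𝓖-heavy)) T⊆𝓖
    where T⊆𝓖 = All.tabulate (𝓕ˢ.heavy⇒⊆ ∣T∣≡t 𝓕-heavy)
  ...   | no  𝓖-light = 𝓖-small (≤-pred (subst (_< suc ℓ′ + K * 𝓖ˢ.E) degree≡length (≰⇒> 𝓖-light)))
    where degree≡length = cong length (filter-all (T ⊆?_) (All.tabulate (𝓕ˢ.heavy⇒⊆ ∣T∣≡t 𝓕-heavy)))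

  product≤⊎k≡t : length 𝓕 * length 𝓖 ≤ 𝓕ˢ.X * 𝓖ˢ.X ⊎ (k ≡ t × length 𝓕 ≤ ℓ′ + K * ℓ′)
  product≤⊎k≡t with outcome
  ... | common-core T ∣T∣≡t T⊆𝓕 T⊆𝓖 = inj₁ (*-mono-≤
          (star-bound-uniform T (distinct 𝓕-uniform) (uniform 𝓕-uniform) ∣T∣≡t t≤k T⊆𝓕)
          (star-bound-uniform T (distinct 𝓖-uniform) (uniform 𝓖-uniform) ∣T∣≡t t≤k′ T⊆𝓖))
  ... | 𝓖-small ∣𝓖∣≤ with 𝓖ᵇ.k≤t×E≡0⊎0<E
  ...   | inj₁ (_ , E≡0) = contradiction ℓ≤∣𝓖∣ (<⇒≱ (s≤s (≤-trans ∣𝓖∣≤ (≤-reflexive (ℓ′+K*E≡ℓ′ E≡0)))))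
  ...   | inj₂ 0<E       = inj₁ (subst₂ _≤_ (*-comm (length 𝓖) (length 𝓕)) (*-comm 𝓖ˢ.X 𝓕ˢ.X)
          (*≤*-via-L² L (≤-trans ∣𝓖∣≤ (crude≤L* 0<K 0<E)) 𝓖ᵇ.LLE≤X (≤-trans 𝓕ˢ.length≤ℓ′+K*X (crude≤L* 0<K 𝓕ᵇ.0<X))))
  product≤⊎k≡t | 𝓕-small ∣𝓕∣≤ with 𝓕ᵇ.k≤t×E≡0⊎0<E
  ...   | inj₁ (k≤t , E≡0) =
          inj₂ (≤-antisym k≤t t≤k , ≤-trans ∣𝓕∣≤ (≤-reflexive (cong (λ e → ℓ′ + K * e) (ℓ′+K*E≡ℓ′ E≡0))))
  ...   | inj₂ 0<E         = inj₁
          (*≤*-via-L² L (≤-trans ∣𝓕∣≤ (small≤L* 0<E)) 𝓕ᵇ.LLE≤X (≤-trans 𝓖ˢ.length≤ℓ′+K*X (crude≤L* 0<K 𝓖ᵇ.0<X)))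

product≤ : ∀ {n} ℓ′ t k k′ K {𝓕 𝓖 : List (Subset n)} → UniformFamily n k 𝓕 → UniformFamily n k′ 𝓖 →
  suc ℓ′ ≤ length 𝓕 → suc ℓ′ ≤ length 𝓖 → WeaklyCrossIntersecting (suc ℓ′) t 𝓕 𝓖 →
  2 ^ (t + suc ℓ′ * k) ≤ K → 2 ^ (t + suc ℓ′ * k′) ≤ K →
  t + Thresholds.L ℓ′ K * Thresholds.L ℓ′ K * k ≤ n → t + Thresholds.L ℓ′ K * Thresholds.L ℓ′ K * k′ ≤ n →
  length 𝓕 * length 𝓖 ≤ ((n ∸ t) C (k ∸ t)) * ((n ∸ t) C (k′ ∸ t))
product≤ {n} ℓ′ t k k′ K {𝓕} {𝓖} 𝓕-uniform 𝓖-uniform ℓ≤∣𝓕∣ ℓ≤∣𝓖∣ W K-large K-large′ n-large n-large′ =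
  combine 𝓕𝓖.product≤⊎k≡t 𝓖𝓕.product≤⊎k≡t
  where
  W′ = weakly-sym {t = t} W
  t≤k  = weakly⇒t≤k 𝓕-uniform 𝓖-uniform ℓ≤∣𝓕∣ ℓ≤∣𝓖∣ W
  t≤k′ = weakly⇒t≤k 𝓖-uniform 𝓕-uniform ℓ≤∣𝓖∣ ℓ≤∣𝓕∣ W′
  module 𝓕𝓖 = TwoSided ℓ′ t k k′ K 𝓕-uniform 𝓖-uniform ℓ≤∣𝓕∣ ℓ≤∣𝓖∣ W  t≤k t≤k′ K-large′ K-large n-large n-large′
  module 𝓖𝓕 = TwoSided ℓ′ t k′ k K 𝓖-uniform 𝓕-uniform ℓ≤∣𝓖∣ ℓ≤∣𝓕∣ W′ t≤k′ t≤k K-large K-large′ n-large′ n-large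

  X Y : ℕ
  X = (n ∸ t) C (k ∸ t)
  Y = (n ∸ t) C (k′ ∸ t)

  combine : length 𝓕 * length 𝓖 ≤ X * Y ⊎ (k ≡ t × length 𝓕 ≤ ℓ′ + K * ℓ′) →
            length 𝓖 * length 𝓕 ≤ Y * X ⊎ (k′ ≡ t × length 𝓖 ≤ ℓ′ + K * ℓ′) →
            length 𝓕 * length 𝓖 ≤ X * Y
  combine (inj₁ bound) _            = bound
  combine (inj₂ _)     (inj₁ bound) = subst₂ _≤_ (*-comm (length 𝓖) (length 𝓕)) (*-comm Y X) bound
  combine (inj₂ (k≡t , ∣𝓕∣≤)) (inj₂ (k′≡t , _)) =
    contradiction ℓ≤∣𝓕∣ (<⇒≱ (s≤s (≤-trans (≤-trans ∣𝓕∣≤ (≤-reflexive ℓ′+Kℓ′≡0)) z≤n)))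
    where
    ℓ′≡0 : ℓ′ ≡ 0
    ℓ′≡0 = suc-injective (weakly-t-uniform⇒ℓ≡1 (subst (λ k → UniformFamily n k 𝓕) k≡t 𝓕-uniform)
                                               (subst (λ k → UniformFamily n k 𝓖) k′≡t 𝓖-uniform) ℓ≤∣𝓕∣ ℓ≤∣𝓖∣ W)
    ℓ′+Kℓ′≡0 : ℓ′ + K * ℓ′ ≡ 0
    ℓ′+Kℓ′≡0 = trans (cong (λ l → l + K * l) ℓ′≡0) (*-zeroʳ K)

theorem1p2 : (k k' ℓ t : ℕ) → 1 ≤ k → 1 ≤ k' → 1 ≤ ℓ → 1 ≤ t →
    ∃[ n₀ ] ((n : ℕ) → n₀ ≤ n →
      (𝓕 𝓕' : List (Subset n)) → UniformFamily n k 𝓕 → UniformFamily n k' 𝓕' →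
      ℓ ≤ length 𝓕 → ℓ ≤ length 𝓕' →
      WeaklyCrossIntersecting ℓ t 𝓕 𝓕' →
      length 𝓕 * length 𝓕' ≤ ((n ∸ t) C (k ∸ t)) * ((n ∸ t) C (k' ∸ t)))
theorem1p2 k k′ zero     t _ _ () _
theorem1p2 k k′ (suc ℓ′) t _ _ _  _ = n₀ , λ n n₀≤n _ _ 𝓕-uniform 𝓖-uniform ℓ≤∣𝓕∣ ℓ≤∣𝓖∣ W →
  product≤ ℓ′ t k k′ K 𝓕-uniform 𝓖-uniform ℓ≤∣𝓕∣ ℓ≤∣𝓖∣ W
    (2^[t+ℓm]≤K (m≤m+n k k′)) (2^[t+ℓm]≤K (m≤n+m k′ k))
    (≤-trans (t+LLm≤n₀ (m≤m+n k k′)) n₀≤n) (≤-trans (t+LLm≤n₀ (m≤n+m k′ k)) n₀≤n)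
  where
  K = 2 ^ (t + suc ℓ′ * (k + k′))
  L = Thresholds.L ℓ′ K
  n₀ = t + L * L * (k + k′)

  2^[t+ℓm]≤K : ∀ {m} → m ≤ k + k′ → 2 ^ (t + suc ℓ′ * m) ≤ K
  2^[t+ℓm]≤K m≤ = ^-monoʳ-≤ 2 (+-monoʳ-≤ t (*-monoʳ-≤ (suc ℓ′) m≤))

  t+LLm≤n₀ : ∀ {m} → m ≤ k + k′ → t + L * L * m ≤ n₀
  t+LLm≤n₀ m≤ = +-monoʳ-≤ t (*-monoʳ-≤ (L * L) m≤)
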